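{- Let $G$ be the join of a nonvacuous complete multipartite graph with one of the following graphs: $2K_2$; $H\cup K_1$ where $H$ is a complete multipartite graph with at least two parts; $P_5$; $C_5$; $C_6$; $2K_3$; $\overline{K_r}\cup K_2$ ($r\geq 2$); $\hat K_2(\overline{K_r},H_1)\cup K_2$ ($r\geq 2$); $\hat K_3(H_1,H_2,H_3)\cup K_2$; $\hat K_2(H_1,H_2)\cup\overline{K_2}$; $2K_2\vee 2K_2$; $2K_2\vee(\hat K_2(H_1,H_2)\cup K_1)$; $2K_2\cup K_1$; $(2K_2\vee H_1)\cup K_1$; $\hat G_3(H_1,H_2,H_3,K_1,K_1)$ for $\hat G_3\in\mathcal{G}_3$; $\hat G_5(H_1,H_2,K_1,K_1)$; $\hat G_5(K_1,H_1,H_2,K_1)$; $\hat G_6(K_1,H_1,H_2,H_3,K_1)$; $\hat G_7(H_1,H_2,H_3,H_4,K_1,K_1)$, where each $H_i$ is a nonvacuous complete multipartite graph. Then $\chi_D(G\cup G)=\chi_D(G)$.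
   Context: $G\cup G$ is the disjoint union of two copies of $G$; $\vee$ is join. A distinguishing $k$-coloring is a partition of the vertex set into exactly $k$ non-empty independent sets such that only the identity automorphism maps every class onto itself; $\chi_D$ is the least such $k$. Complete multipartite graphs include edgeless and complete graphs; nonvacuous means at least one vertex. For a graph $F$ on $(v_1,\dots,v_m)$ and disjoint graphs $H_1,\dots,H_m$, $F(H_1,\dots,H_m)$ replaces each $v_i$ by $H_i$ and each edge $v_iv_j$ by $H_i\vee H_j$. $\hat K_2,\hat K_3$ are labelled complete graphs on 2, 3 vertices. $\hat G_5$: vertices $v_1,\dots,v_4$, edges $v_1v_2,v_2v_3,v_3v_4$. $\hat G_6$: vertices $v_1,\dots,v_5$, edges $v_1v_2,v_2v_3,v_3v_4,v_2v_4$. $\hat G_7$: vertices $v_1,\dots,v_6$, edges $v_1v_2,v_1v_3,v_1v_4,v_2v_3,v_2v_4,v_3v_4,v_4v_5,v_5v_6,v_6v_1,v_6v_2,v_5v_3$. $\mathcal{G}_3$: the two labelled graphs on $v_1,\dots,v_5$ with edges $v_1v_2,v_1v_3,v_2v_3,v_2v_4,v_3v_5$, without and with the extra edge $v_4v_5$. -}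

module Defs where

open import Data.Nat using (ℕ; zero; suc; _+_)
open import Data.Fin using (Fin; splitAt; _≟_) renaming (zero to fz; suc to fs)
open import Data.Bool using (Bool; true; false; _∧_; _∨_; not)
open import Data.List using (List; []; _∷_)
open import Data.List.NonEmpty using (List⁺; _∷_)
open import Data.Product using (Σ; _×_; _,_; ∃; proj₁; proj₂)
open import Data.Sum using (inj₁; inj₂)
open import Data.Vec using (Vec; lookup) renaming ([] to []ᵥ; _∷_ to _∷ᵥ_)
open import Relation.Nullary using (yes; no)
open import Relation.Nullary.Decidable using (⌊_⌋)
open import Relation.Binary.PropositionalEquality using (_≡_; refl)

-- Finite graphs on vertex set Fin n, adjacency as a Bool-valued relation.
-- All graphs built below are simple (symmetric, irreflexive adjacency).

record Graph : Set where
  constructor mkGraph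
  field
    n : ℕ
    E : Fin n → Fin n → Bool
open Graph public

Kbar : ℕ → Graph
Kbar r = mkGraph r (λ _ _ → false)

K : ℕ → Graph
K r = mkGraph r (λ i j → not ⌊ i ≟ j ⌋)

_∪_ : Graph → Graph → Graph
G ∪ H = mkGraph (n G + n H) adj
  where
  adj : Fin (n G + n H) → Fin (n G + n H) → Bool
  adj x y with splitAt (n G) x | splitAt (n G) y
  ... | inj₁ a | inj₁ b = E G a b
  ... | inj₂ a | inj₂ b = E H a b
  ... | _      | _      = false

_⊕_ : Graph → Graph → Graph
G ⊕ H = mkGraph (n G + n H) adj
  where
  adj : Fin (n G + n H) → Fin (n G + n H) → Bool
  adj x y with splitAt (n G) x | splitAt (n G) y
  ... | inj₁ a | inj₁ b = E G a b
  ... | inj₂ a | inj₂ b = E H a b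
  ... | _      | _      = true

infixr 6 _∪_
infixr 7 _⊕_

-- Complete multipartite graph with parts of sizes suc p for p in the list
-- (iterated join of edgeless graphs; the empty list gives the empty graph).
CMPl : List ℕ → Graph
CMPl []       = Kbar 0
CMPl (p ∷ ps) = Kbar (suc p) ⊕ CMPl ps

CMP : List⁺ ℕ → Graph
CMP (p ∷ ps) = CMPl (p ∷ ps)

fromEdges : (m : ℕ) → List (Fin m × Fin m) → Graph
fromEdges m es = mkGraph m (λ i j → go i j es)
  where
  go : Fin m → Fin m → List (Fin m × Fin m) → Bool
  go i j []             = false
  go i j ((a , b) ∷ xs) =
    (⌊ i ≟ a ⌋ ∧ ⌊ j ≟ b ⌋) ∨ (⌊ i ≟ b ⌋ ∧ ⌊ j ≟ a ⌋) ∨ go i j xs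

-- Substitution F(H_1,…,H_m): vertex v_i of F replaced by H_i,
-- each edge v_i v_j replaced by the join H_i ∨ H_j.
vsize : (m : ℕ) → (Fin m → Graph) → ℕ
vsize zero    H = 0
vsize (suc m) H = n (H fz) + vsize m (λ i → H (fs i))

locate : (m : ℕ) (H : Fin m → Graph) → Fin (vsize m H) → Σ (Fin m) (λ i → Fin (n (H i)))
locate zero    H ()
locate (suc m) H x with splitAt (n (H fz)) x
... | inj₁ a = fz , a
... | inj₂ b with locate m (λ i → H (fs i)) b
...   | i , c = fs i , c

substF : (F : Graph) → (Fin (n F) → Graph) → Graph
substF F H = mkGraph (vsize (n F) H) adj
  where
  blockAdj : (i j : Fin (n F)) → Fin (n (H i)) → Fin (n (H j)) → Bool
  blockAdj i j a b with i ≟ j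
  ... | yes refl = E (H i) a b
  ... | no _     = E F i j
  adj : Fin (vsize (n F) H) → Fin (vsize (n F) H) → Bool
  adj x y = blockAdj (proj₁ (locate (n F) H x)) (proj₁ (locate (n F) H y))
                     (proj₂ (locate (n F) H x)) (proj₂ (locate (n F) H y))

_⟨_⟩ : (F : Graph) → Vec Graph (n F) → Graph
F ⟨ Hs ⟩ = substF F (lookup Hs)

v1 : ∀ {m} → Fin (1 + m)
v2 : ∀ {m} → Fin (2 + m)
v3 : ∀ {m} → Fin (3 + m)
v4 : ∀ {m} → Fin (4 + m)
v5 : ∀ {m} → Fin (5 + m)
v6 : ∀ {m} → Fin (6 + m)
v1 = fz
v2 = fs fz
v3 = fs (fs fz)
v4 = fs (fs (fs fz))
v5 = fs (fs (fs (fs fz)))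
v6 = fs (fs (fs (fs (fs fz))))

K̂₂ : Graph
K̂₂ = fromEdges 2 ((fz , fs fz) ∷ [])

K̂₃ : Graph
K̂₃ = fromEdges 3 ((fz , fs fz) ∷ (fz , fs (fs fz)) ∷ (fs fz , fs (fs fz)) ∷ [])

K₁ : Graph
K₁ = K 1

P₅ : Graph
P₅ = fromEdges 5 ((v1 , v2) ∷ (v2 , v3) ∷ (v3 , v4) ∷ (v4 , v5) ∷ [])

C₅ : Graph
C₅ = fromEdges 5 ((v1 , v2) ∷ (v2 , v3) ∷ (v3 , v4) ∷ (v4 , v5) ∷ (v5 , v1) ∷ [])

C₆ : Graph
C₆ = fromEdges 6 ((v1 , v2) ∷ (v2 , v3) ∷ (v3 , v4) ∷ (v4 , v5) ∷ (v5 , v6) ∷ (v6 , v1) ∷ [])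

twoK₂ : Graph
twoK₂ = K 2 ∪ K 2

-- the two members of 𝒢₃
Ĝ₃a Ĝ₃b : Graph
Ĝ₃a = fromEdges 5 ((v1 , v2) ∷ (v1 , v3) ∷ (v2 , v3) ∷ (v2 , v4) ∷ (v3 , v5) ∷ [])
Ĝ₃b = fromEdges 5 ((v1 , v2) ∷ (v1 , v3) ∷ (v2 , v3) ∷ (v2 , v4) ∷ (v3 , v5) ∷ (v4 , v5) ∷ [])

Ĝ₅ : Graph
Ĝ₅ = fromEdges 4 ((v1 , v2) ∷ (v2 , v3) ∷ (v3 , v4) ∷ [])

Ĝ₆ : Graph
Ĝ₆ = fromEdges 5 ((v1 , v2) ∷ (v2 , v3) ∷ (v3 , v4) ∷ (v2 , v4) ∷ [])

Ĝ₇ : Graph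
Ĝ₇ = fromEdges 6 ((v1 , v2) ∷ (v1 , v3) ∷ (v1 , v4) ∷ (v2 , v3) ∷ (v2 , v4) ∷ (v3 , v4)
                 ∷ (v4 , v5) ∷ (v5 , v6) ∷ (v6 , v1) ∷ (v6 , v2) ∷ (v5 , v3) ∷ [])

-- The list of graphs X in Lemma 5.9 (G = A ∨ X, A nonvacuous complete
-- multipartite). Each H_i is a nonvacuous complete multipartite graph CMP h.

data Listed : Graph → Set where
  l2K₂     : Listed twoK₂
  lHK₁     : (p q : ℕ) (qs : List ℕ) → Listed (CMPl (p ∷ q ∷ qs) ∪ K₁)
  lP₅      : Listed P₅
  lC₅      : Listed C₅
  lC₆      : Listed C₆
  l2K₃     : Listed (K 3 ∪ K 3)
  lKbarK₂  : (r : ℕ) → 2 Data.Nat.≤ r → Listed (Kbar r ∪ K 2)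
  lK₂K₂    : (r : ℕ) → 2 Data.Nat.≤ r → (h₁ : List⁺ ℕ) →
             Listed (K̂₂ ⟨ Kbar r ∷ᵥ CMP h₁ ∷ᵥ []ᵥ ⟩ ∪ K 2)
  lK₃K₂    : (h₁ h₂ h₃ : List⁺ ℕ) →
             Listed (K̂₃ ⟨ CMP h₁ ∷ᵥ CMP h₂ ∷ᵥ CMP h₃ ∷ᵥ []ᵥ ⟩ ∪ K 2)
  lK₂Kbar₂ : (h₁ h₂ : List⁺ ℕ) →
             Listed (K̂₂ ⟨ CMP h₁ ∷ᵥ CMP h₂ ∷ᵥ []ᵥ ⟩ ∪ Kbar 2)
  l2K₂2K₂  : Listed (twoK₂ ⊕ twoK₂)
  l2K₂K₂K₁ : (h₁ h₂ : List⁺ ℕ) →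
             Listed (twoK₂ ⊕ (K̂₂ ⟨ CMP h₁ ∷ᵥ CMP h₂ ∷ᵥ []ᵥ ⟩ ∪ K₁))
  l2K₂K₁   : Listed (twoK₂ ∪ K₁)
  l2K₂HK₁  : (h₁ : List⁺ ℕ) → Listed ((twoK₂ ⊕ CMP h₁) ∪ K₁)
  lG₃a     : (h₁ h₂ h₃ : List⁺ ℕ) →
             Listed (Ĝ₃a ⟨ CMP h₁ ∷ᵥ CMP h₂ ∷ᵥ CMP h₃ ∷ᵥ K₁ ∷ᵥ K₁ ∷ᵥ []ᵥ ⟩)
  lG₃b     : (h₁ h₂ h₃ : List⁺ ℕ) →
             Listed (Ĝ₃b ⟨ CMP h₁ ∷ᵥ CMP h₂ ∷ᵥ CMP h₃ ∷ᵥ K₁ ∷ᵥ K₁ ∷ᵥ []ᵥ ⟩)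
  lG₅a     : (h₁ h₂ : List⁺ ℕ) →
             Listed (Ĝ₅ ⟨ CMP h₁ ∷ᵥ CMP h₂ ∷ᵥ K₁ ∷ᵥ K₁ ∷ᵥ []ᵥ ⟩)
  lG₅b     : (h₁ h₂ : List⁺ ℕ) →
             Listed (Ĝ₅ ⟨ K₁ ∷ᵥ CMP h₁ ∷ᵥ CMP h₂ ∷ᵥ K₁ ∷ᵥ []ᵥ ⟩)
  lG₆      : (h₁ h₂ h₃ : List⁺ ℕ) →
             Listed (Ĝ₆ ⟨ K₁ ∷ᵥ CMP h₁ ∷ᵥ CMP h₂ ∷ᵥ CMP h₃ ∷ᵥ K₁ ∷ᵥ []ᵥ ⟩)
  lG₇      : (h₁ h₂ h₃ h₄ : List⁺ ℕ) →
             Listed (Ĝ₇ ⟨ CMP h₁ ∷ᵥ CMP h₂ ∷ᵥ CMP h₃ ∷ᵥ CMP h₄ ∷ᵥ K₁ ∷ᵥ K₁ ∷ᵥ []ᵥ ⟩)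

record Automorphism (G : Graph) : Set where
  field
    σ     : Fin (n G) → Fin (n G)
    σ⁻¹   : Fin (n G) → Fin (n G)
    inv₁  : ∀ i → σ (σ⁻¹ i) ≡ i
    inv₂  : ∀ i → σ⁻¹ (σ i) ≡ i
    pres  : ∀ i j → E G (σ i) (σ j) ≡ E G i j

record DistColoring (G : Graph) (k : ℕ) : Set where
  field
    c           : Fin (n G) → Fin k
    nonempty    : ∀ (a : Fin k) → ∃ λ i → c i ≡ a
    independent : ∀ i j → c i ≡ c j → E G i j ≡ false
    distinguish : ∀ (φ : Automorphism G) →
                  (∀ i → c (Automorphism.σ φ i) ≡ c i) →
                  ∀ i → Automorphism.σ φ i ≡ i

IsChiD : Graph → ℕ → Set
IsChiD G k = DistColoring G k × (∀ j → j Data.Nat.< k → DistColoring G j → Data.Empty.⊥)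
  where import Data.Empty

{-# OPTIONS --safe #-}
-- Let G = A ∨ X have n vertices. A vertex x₀ of the first part of A is a twin of each
-- of its non-neighbours, so its colour class is {x₀} in every distinguishing colouring;
-- G has diameter at most 2, so automorphisms of G ∪ G permute the two copies; and X
-- has non-adjacent u, v with a neighbour of u that is not one of v, so colouring {u, v}
-- alike and all other vertices apart is distinguishing. Hence both χ_D(G) and
-- χ_D(G ∪ G) are below n. A distinguishing colouring of G ∪ G restricts to one copy,
-- and with at most n colours one can recolour vertices of repeated classes until every
-- colour is used. Conversely, a distinguishing k-colouring of G with k < n has a class
-- with two vertices; colouring the second copy with that colour and the colour of x₀
-- exchanged gives copies that no automorphism can swap, hence a distinguishing
-- k-colouring of G ∪ G.
module Submission where

open import Defs
open import Data.Nat using (ℕ; zero; suc; _+_; _≤_; _<_; pred; s≤s)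
open import Data.Nat.Properties using (m≤pred[n]⇒suc[m]≤n; ≤-refl; <-trans; <⇒≤; ≤-<-trans; ≮⇒≥; m<1+n⇒m<n∨m≡n)
open import Data.Fin using (Fin; splitAt; _≟_; _↑ˡ_; _↑ʳ_; punchOut; punchIn; toℕ; fromℕ<)
  renaming (zero to fz; suc to fs)
open import Data.Fin.Properties
  using (splitAt-↑ˡ; splitAt-↑ʳ; splitAt⁻¹-↑ˡ; splitAt⁻¹-↑ʳ; ↑ˡ-injective; ↑ʳ-injective;
         punchOut-injective; punchOut-punchIn; punchInᵢ≢i; pigeonhole; <⇒≢; any?;
         toℕ-injective; toℕ-fromℕ<; toℕ<n; nonZeroIndex)
open import Data.Fin.Permutation.Components using (transpose; transpose-inverse)
open import Data.Vec.Functional using (updateAt)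
open import Data.Vec.Functional.Properties using (updateAt-updates; updateAt-minimal)
open import Data.Bool using (true; false)
open import Data.Sum using (inj₁; inj₂; _⊎_; [_,_]′)
open import Data.Product using (Σ; _×_; _,_; ∃; proj₁; proj₂)
open import Data.Empty using (⊥; ⊥-elim)
open import Function using (id; const; _∘_)
open import Data.List using (_∷_)
open import Data.List.NonEmpty using (List⁺; _∷_)
open import Data.Vec using (Vec; lookup) renaming ([] to []ᵥ; _∷_ to _∷ᵥ_)
open import Relation.Nullary using (Dec; yes; no)
open import Relation.Binary.PropositionalEquality

data View (a b : ℕ) : Fin (a + b) → Set where
  L : (i : Fin a) → View a b (i ↑ˡ b)
  R : (j : Fin b) → View a b (a ↑ʳ j)

view : ∀ a b (x : Fin (a + b)) → View a b x
view a b x with splitAt a x in eq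
... | inj₁ i rewrite sym (splitAt⁻¹-↑ˡ eq) = L i
... | inj₂ j rewrite sym (splitAt⁻¹-↑ʳ eq) = R j

module _ (G H : Graph) where

  ∪-ll : ∀ i j → E (G ∪ H) (i ↑ˡ n H) (j ↑ˡ n H) ≡ E G i j
  ∪-ll i j rewrite splitAt-↑ˡ (n G) i (n H) | splitAt-↑ˡ (n G) j (n H) = refl

  ∪-rr : ∀ i j → E (G ∪ H) (n G ↑ʳ i) (n G ↑ʳ j) ≡ E H i j
  ∪-rr i j rewrite splitAt-↑ʳ (n G) (n H) i | splitAt-↑ʳ (n G) (n H) j = refl

  ∪-lr : ∀ i j → E (G ∪ H) (i ↑ˡ n H) (n G ↑ʳ j) ≡ false
  ∪-lr i j rewrite splitAt-↑ˡ (n G) i (n H) | splitAt-↑ʳ (n G) (n H) j = refl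

  ∪-rl : ∀ i j → E (G ∪ H) (n G ↑ʳ i) (j ↑ˡ n H) ≡ false
  ∪-rl i j rewrite splitAt-↑ʳ (n G) (n H) i | splitAt-↑ˡ (n G) j (n H) = refl

  ⊕-ll : ∀ i j → E (G ⊕ H) (i ↑ˡ n H) (j ↑ˡ n H) ≡ E G i j
  ⊕-ll i j rewrite splitAt-↑ˡ (n G) i (n H) | splitAt-↑ˡ (n G) j (n H) = refl

  ⊕-rr : ∀ i j → E (G ⊕ H) (n G ↑ʳ i) (n G ↑ʳ j) ≡ E H i j
  ⊕-rr i j rewrite splitAt-↑ʳ (n G) (n H) i | splitAt-↑ʳ (n G) (n H) j = refl

  ⊕-lr : ∀ i j → E (G ⊕ H) (i ↑ˡ n H) (n G ↑ʳ j) ≡ true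
  ⊕-lr i j rewrite splitAt-↑ˡ (n G) i (n H) | splitAt-↑ʳ (n G) (n H) j = refl

  ⊕-rl : ∀ i j → E (G ⊕ H) (n G ↑ʳ i) (j ↑ˡ n H) ≡ true
  ⊕-rl i j rewrite splitAt-↑ʳ (n G) (n H) i | splitAt-↑ˡ (n G) j (n H) = refl

Irreflexive : Graph → Set
Irreflexive G = ∀ i → E G i i ≡ false

irreflexive : ∀ {G k} → DistColoring G k → Irreflexive G
irreflexive D i = DistColoring.independent D i i refl

idAut : (G : Graph) → Automorphism G
idAut G = record { σ = id ; σ⁻¹ = id ; inv₁ = λ _ → refl ; inv₂ = λ _ → refl ; pres = λ _ _ → refl }

module _ {G : Graph} (φ : Automorphism G) where
  open Automorphism φ

  aut⁻¹ : Automorphism G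
  aut⁻¹ = record
    { σ = σ⁻¹ ; σ⁻¹ = σ ; inv₁ = inv₂ ; inv₂ = inv₁
    ; pres = λ i j → trans (sym (pres (σ⁻¹ i) (σ⁻¹ j))) (cong₂ (E G) (inv₁ i) (inv₁ j)) }

  σ-injective : ∀ {i j} → σ i ≡ σ j → i ≡ j
  σ-injective {i} {j} e = trans (sym (inv₂ i)) (trans (cong σ⁻¹ e) (inv₂ j))

transpose-cases : ∀ {m} (u w k : Fin m) →
  (k ≡ u × transpose u w k ≡ w) ⊎ (k ≡ w × transpose u w k ≡ u) ⊎ transpose u w k ≡ k
transpose-cases u w k with k ≟ u
... | yes k≡u = inj₁ (k≡u , refl)
... | no _ with k ≟ w
...   | yes k≡w = inj₂ (inj₁ (k≡w , refl))
...   | no _ = inj₂ (inj₂ refl)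

transpose-first : ∀ {m} (u w : Fin m) → transpose u w u ≡ w
transpose-first u w with u ≟ u
... | yes _ = refl
... | no u≢u = ⊥-elim (u≢u refl)

Twins : (G : Graph) → Fin (n G) → Fin (n G) → Set
Twins G u w = (∀ y → E G u y ≡ E G w y) × (∀ y → E G y u ≡ E G y w)

module _ {G : Graph} {u w : Fin (n G)} (tw : Twins G u w) where

  transpose-row : ∀ i j → E G (transpose u w i) j ≡ E G i j
  transpose-row i j with transpose-cases u w i
  ... | inj₁ (refl , t) rewrite t = sym (proj₁ tw j)
  ... | inj₂ (inj₁ (refl , t)) rewrite t = proj₁ tw j
  ... | inj₂ (inj₂ t) rewrite t = refl

  transpose-column : ∀ i j → E G i (transpose u w j) ≡ E G i j
  transpose-column i j with transpose-cases u w j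
  ... | inj₁ (refl , t) rewrite t = sym (proj₂ tw i)
  ... | inj₂ (inj₁ (refl , t)) rewrite t = proj₂ tw i
  ... | inj₂ (inj₂ t) rewrite t = refl

  twinTransposition : Automorphism G
  twinTransposition = record
    { σ = transpose u w ; σ⁻¹ = transpose w u
    ; inv₁ = λ _ → transpose-inverse u w ; inv₂ = λ _ → transpose-inverse w u
    ; pres = λ i j → trans (transpose-row i (transpose u w j)) (transpose-column i j) }

  same-colour-twins⇒≡ : ∀ {k} (D : DistColoring G k) →
    DistColoring.c D u ≡ DistColoring.c D w → u ≡ w
  same-colour-twins⇒≡ D cu≡cw =
    trans (sym (distinguish twinTransposition keeps u)) (transpose-first u w)
    where
    open DistColoring D
    keeps : ∀ i → c (transpose u w i) ≡ c i
    keeps i with transpose-cases u w i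
    ... | inj₁ (refl , t) rewrite t = sym cu≡cw
    ... | inj₂ (inj₁ (refl , t)) rewrite t = cu≡cw
    ... | inj₂ (inj₂ t) rewrite t = refl

NonNeighboursAreTwins : (G : Graph) → Fin (n G) → Set
NonNeighboursAreTwins G x = ∀ i → E G x i ≡ false → Twins G x i

colour-class-singleton : ∀ {G k x} → NonNeighboursAreTwins G x → (D : DistColoring G k) →
  ∀ i → DistColoring.c D i ≡ DistColoring.c D x → i ≡ x
colour-class-singleton {x = x} nnt D i ci≡cx =
  sym (same-colour-twins⇒≡ (nnt i (independent x i (sym ci≡cx))) D (sym ci≡cx))
  where open DistColoring D

record DistMap (G : Graph) (k : ℕ) : Set where
  field
    c           : Fin (n G) → Fin k
    independent : ∀ i j → c i ≡ c j → E G i j ≡ false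
    distinguish : ∀ (φ : Automorphism G) →
                  (∀ i → c (Automorphism.σ φ i) ≡ c i) →
                  ∀ i → Automorphism.σ φ i ≡ i

refine : ∀ {G k l} (P : DistMap G k) (c′ : Fin (n G) → Fin l) →
  (∀ i j → c′ i ≡ c′ j → DistMap.c P i ≡ DistMap.c P j) → DistMap G l
refine P c′ finer = record
  { c = c′
  ; independent = λ i j e → independent i j (finer i j e)
  ; distinguish = λ φ keeps → distinguish φ (λ i → finer _ i (keeps i)) }
  where open DistMap P

Covers : ∀ {m k} → (Fin m → Fin k) → ℕ → Set
Covers c t = ∀ a → toℕ a < t → ∃ λ i → c i ≡ a

covers-suc : ∀ {m k t} {c : Fin m → Fin k} (t<k : t < k) →
  Covers c t → (∃ λ i → c i ≡ fromℕ< t<k) → Covers c (suc t)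
covers-suc {t = t} t<k covers (i , ci≡t) a a<1+t with m<1+n⇒m<n∨m≡n a<1+t
... | inj₁ a<t = covers a a<t
... | inj₂ a≡t = i , trans ci≡t (toℕ-injective (trans (toℕ-fromℕ< t<k) (sym a≡t)))

module Surjectify {G : Graph} {k : ℕ} (k≤n : k ≤ n G) where

  -- When colour t is missing, k ≤ n G forces a class with two vertices p, q;
  -- giving p the missing colour refines the map and keeps every colour below t.
  cover-next : ∀ {t} (P : DistMap G k) → Covers (DistMap.c P) t → t < k →
               Σ (DistMap G k) (λ P′ → Covers (DistMap.c P′) (suc t))
  cover-next P covers t<k with any? (λ i → DistMap.c P i ≟ fromℕ< t<k)
  ... | yes t-used = P , covers-suc t<k covers t-used
  cover-next {t} P covers t<k@(s≤s _) | no missing =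
    refine P c′ finer , covers-suc t<k covers′ (p , updateAt-updates p c)
    where
    open DistMap P
    new = fromℕ< t<k
    c⁻ : Fin (n G) → Fin _
    c⁻ i = punchOut {i = new} {j = c i} (λ e → missing (i , sym e))
    clash = pigeonhole k≤n c⁻
    p = proj₁ clash
    q = proj₁ (proj₂ clash)
    q≢p : q ≢ p
    q≢p e = <⇒≢ (proj₁ (proj₂ (proj₂ clash))) (sym e)
    cp≡cq : c p ≡ c q
    cp≡cq = punchOut-injective (λ e → missing (p , sym e)) (λ e → missing (q , sym e))
                               (proj₂ (proj₂ (proj₂ clash)))
    c′ : Fin (n G) → Fin _
    c′ = updateAt c p (const new)
    c′-elsewhere : ∀ {i} → i ≢ p → c′ i ≡ c i
    c′-elsewhere {i} i≢p = updateAt-minimal i p c i≢p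
    finer : ∀ i j → c′ i ≡ c′ j → c i ≡ c j
    finer i j e with i ≟ p | j ≟ p
    ... | yes refl | yes refl = refl
    ... | yes refl | no  j≢p =
      ⊥-elim (missing (j , trans (sym (c′-elsewhere j≢p)) (trans (sym e) (updateAt-updates p c))))
    ... | no  i≢p  | yes refl =
      ⊥-elim (missing (i , trans (sym (c′-elsewhere i≢p)) (trans e (updateAt-updates p c))))
    ... | no  i≢p  | no  j≢p  = trans (sym (c′-elsewhere i≢p)) (trans e (c′-elsewhere j≢p))
    covers′ : Covers c′ t
    covers′ a a<t with covers a a<t
    ... | i , ci≡a with i ≟ p
    ...   | no  i≢p  = i , trans (c′-elsewhere i≢p) ci≡a
    ...   | yes refl = q , trans (c′-elsewhere q≢p) (trans (sym cp≡cq) ci≡a)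

  cover-upto : DistMap G k → ∀ t → t ≤ k → Σ (DistMap G k) (λ P′ → Covers (DistMap.c P′) t)
  cover-upto P zero    _     = P , λ _ ()
  cover-upto P (suc t) t<k with cover-upto P t (<⇒≤ t<k)
  ... | P′ , covers = cover-next P′ covers t<k

  surjectify : DistMap G k → DistColoring G k
  surjectify P with cover-upto P k ≤-refl
  ... | P′ , covers = record
    { c = c ; nonempty = λ a → covers a (toℕ<n a) ; independent = independent ; distinguish = distinguish }
    where open DistMap P′

record SplitNonEdge (G : Graph) : Set where
  constructor splitNonEdge
  field
    u v w : Fin (n G)
    u≁v : E G u v ≡ false
    v≁u : E G v u ≡ false
    u∼w : E G u w ≡ true
    v≁w : E G v w ≡ false

identify : ∀ {m} (u v : Fin (suc m)) → v ≢ u → Fin (suc m) → Fin m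
identify u v v≢u i with i ≟ v
... | yes _ = punchOut v≢u
... | no i≢v = punchOut {i = v} {j = i} (λ e → i≢v (sym e))

identify-fibres : ∀ {m} (u v : Fin (suc m)) (v≢u : v ≢ u) x y →
  identify u v v≢u x ≡ identify u v v≢u y → x ≡ y ⊎ (x ≡ u × y ≡ v) ⊎ (x ≡ v × y ≡ u)
identify-fibres u v v≢u x y e with x ≟ v | y ≟ v
... | yes x≡v | yes y≡v = inj₁ (trans x≡v (sym y≡v))
... | yes x≡v | no  y≢v = inj₂ (inj₂ (x≡v , sym (punchOut-injective v≢u _ e)))
... | no  x≢v | yes y≡v = inj₂ (inj₁ (punchOut-injective _ v≢u e , y≡v))
... | no  x≢v | no  y≢v = inj₁ (punchOut-injective {i = v} _ _ e)

identify-surjective : ∀ {m} (u v : Fin (suc m)) (v≢u : v ≢ u) a → identify u v v≢u (punchIn v a) ≡ a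
identify-surjective u v v≢u a with punchIn v a ≟ v
... | yes e = ⊥-elim (punchInᵢ≢i v a e)
... | no _  = punchOut-punchIn v

distinct-by-neighbour : ∀ {G a b w} → E G a w ≡ true → E G b w ≡ false → a ≢ b
distinct-by-neighbour a∼w b≁w refl with trans (sym a∼w) b≁w
... | ()

-- All classes are singletons except {u, v}; the neighbour w of u tells u from v.
identifyColoring : (G : Graph) → Irreflexive G → SplitNonEdge G → DistColoring G (pred (n G))
identifyColoring (mkGraph zero _) _ s with SplitNonEdge.u s
... | ()
identifyColoring G@(mkGraph (suc m) _) irr (splitNonEdge u v w u≁v v≁u u∼w v≁w) = record
  { c = c
  ; nonempty = λ a → punchIn v a , identify-surjective u v v≢u a
  ; independent = independent
  ; distinguish = distinguish }
  where
  u≢v : u ≢ v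
  u≢v = distinct-by-neighbour {G} u∼w v≁w
  v≢u : v ≢ u
  v≢u e = u≢v (sym e)
  w≢u : w ≢ u
  w≢u refl with trans (sym u∼w) (irr u)
  ... | ()
  w≢v : w ≢ v
  w≢v refl with trans (sym u∼w) u≁v
  ... | ()
  c = identify u v v≢u
  independent : ∀ i j → c i ≡ c j → E G i j ≡ false
  independent i j e with identify-fibres u v v≢u i j e
  ... | inj₁ refl = irr i
  ... | inj₂ (inj₁ (refl , refl)) = u≁v
  ... | inj₂ (inj₂ (refl , refl)) = v≁u
  distinguish : ∀ (φ : Automorphism G) → (∀ i → c (Automorphism.σ φ i) ≡ c i) →
                ∀ i → Automorphism.σ φ i ≡ i
  distinguish φ keeps = fixes
    where
    open Automorphism φ
    fixes-others : ∀ {i} → i ≢ u → i ≢ v → σ i ≡ i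
    fixes-others {i} i≢u i≢v with identify-fibres u v v≢u _ _ (keeps i)
    ... | inj₁ σi≡i = σi≡i
    ... | inj₂ (inj₁ (_ , i≡v)) = ⊥-elim (i≢v i≡v)
    ... | inj₂ (inj₂ (_ , i≡u)) = ⊥-elim (i≢u i≡u)
    σw≡w : σ w ≡ w
    σw≡w = fixes-others w≢u w≢v
    σu≡u : σ u ≡ u
    σu≡u with identify-fibres u v v≢u _ _ (keeps u)
    ... | inj₁ σu≡u = σu≡u
    ... | inj₂ (inj₁ (_ , u≡v)) = ⊥-elim (u≢v u≡v)
    ... | inj₂ (inj₂ (σu≡v , _)) = ⊥-elim (
      distinct-by-neighbour {G} (trans (cong (E G (σ u)) (sym σw≡w)) (trans (pres u w) u∼w))
                                v≁w σu≡v)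
    σv≡v : σ v ≡ v
    σv≡v with identify-fibres u v v≢u _ _ (keeps v)
    ... | inj₁ σv≡v = σv≡v
    ... | inj₂ (inj₁ (σv≡u , _)) = ⊥-elim (v≢u (σ-injective φ (trans σv≡u (sym σu≡u))))
    ... | inj₂ (inj₂ (_ , v≡u)) = ⊥-elim (v≢u v≡u)
    fixes : ∀ i → σ i ≡ i
    fixes i with i ≟ u | i ≟ v
    ... | yes refl | _        = σu≡u
    ... | no  _    | yes refl = σv≡v
    ... | no  i≢u  | no  i≢v  = fixes-others i≢u i≢v

Dist≤2 : (G : Graph) → Fin (n G) → Fin (n G) → Set
Dist≤2 G y z = y ≡ z ⊎ E G y z ≡ true ⊎ ∃ λ w → E G y w ≡ true × E G w z ≡ true

Diameter≤2 : Graph → Set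
Diameter≤2 G = ∀ y z → Dist≤2 G y z

map-dist≤2 : ∀ {G H} (f : Fin (n G) → Fin (n H)) → (∀ i j → E H (f i) (f j) ≡ E G i j) →
  ∀ {y z} → Dist≤2 G y z → Dist≤2 H (f y) (f z)
map-dist≤2 f pres (inj₁ refl)                 = inj₁ refl
map-dist≤2 f pres (inj₂ (inj₁ y∼z))           = inj₂ (inj₁ (trans (pres _ _) y∼z))
map-dist≤2 f pres (inj₂ (inj₂ (w , y∼w , w∼z))) =
  inj₂ (inj₂ (f w , trans (pres _ _) y∼w , trans (pres _ _) w∼z))

data Copy : Set where
  left right : Copy

_≟ᶜ_ : (s t : Copy) → Dec (s ≡ t)
left  ≟ᶜ left  = yes refl
right ≟ᶜ right = yes refl
left  ≟ᶜ right = no λ ()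
right ≟ᶜ left  = no λ ()

module Double (G : Graph) where

  GG : Graph
  GG = G ∪ G

  copy : Copy → Fin (n G) → Fin (n GG)
  copy left  i = i ↑ˡ n G
  copy right i = n G ↑ʳ i

  data CopyView : Fin (n GG) → Set where
    ⟨_,_⟩ : ∀ s i → CopyView (copy s i)

  copyView : ∀ x → CopyView x
  copyView x with view (n G) (n G) x
  ... | L i = ⟨ left , i ⟩
  ... | R i = ⟨ right , i ⟩

  copywise : {A : Set} → (Copy → Fin (n G) → A) → Fin (n GG) → A
  copywise f x = [ f left , f right ]′ (splitAt (n G) x)

  copywise-copy : {A : Set} (f : Copy → Fin (n G) → A) → ∀ s i → copywise f (copy s i) ≡ f s i
  copywise-copy f left  i rewrite splitAt-↑ˡ (n G) i (n G) = refl
  copywise-copy f right i rewrite splitAt-↑ʳ (n G) (n G) i = refl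

  copy-injective : ∀ {s t i j} → copy s i ≡ copy t j → s ≡ t × i ≡ j
  copy-injective {left}  {left}  e = refl , ↑ˡ-injective (n G) _ _ e
  copy-injective {right} {right} e = refl , ↑ʳ-injective (n G) _ _ e
  copy-injective {left}  {right} {i} {j} e
    with trans (sym (splitAt-↑ˡ (n G) i (n G))) (trans (cong (splitAt (n G)) e) (splitAt-↑ʳ (n G) (n G) j))
  ... | ()
  copy-injective {right} {left}  {i} {j} e
    with trans (sym (splitAt-↑ʳ (n G) (n G) i)) (trans (cong (splitAt (n G)) e) (splitAt-↑ˡ (n G) j (n G)))
  ... | ()

  copy-adj : ∀ s i j → E GG (copy s i) (copy s j) ≡ E G i j
  copy-adj left  = ∪-ll G G
  copy-adj right = ∪-rr G G

  copy-cross : ∀ s t → s ≢ t → ∀ i j → E GG (copy s i) (copy t j) ≡ false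
  copy-cross left  left  s≢t = ⊥-elim (s≢t refl)
  copy-cross left  right _   = ∪-lr G G
  copy-cross right left  _   = ∪-rl G G
  copy-cross right right s≢t = ⊥-elim (s≢t refl)

  InCopy : Copy → Fin (n GG) → Set
  InCopy t x = ∃ λ z → x ≡ copy t z

  copyOf : ∀ x → Σ Copy λ t → InCopy t x
  copyOf x with copyView x
  ... | ⟨ s , i ⟩ = s , i , refl

  same-copy : ∀ s t i j → E GG (copy s i) (copy t j) ≡ true → s ≡ t
  same-copy s t i j e with s ≟ᶜ t
  ... | yes s≡t = s≡t
  ... | no  s≢t with trans (sym e) (copy-cross s t s≢t i j)
  ...   | ()

  adjacent-in-copy : ∀ t {x y} → InCopy t x → E GG x y ≡ true → InCopy t y
  adjacent-in-copy t {y = y} (i , refl) i∼y with copyView y | i∼y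
  ... | ⟨ s , j ⟩ | i∼j with same-copy t s i j i∼j
  ...   | refl = j , refl

  dist≤2-in-copy : ∀ t {x y} → InCopy t x → Dist≤2 GG x y → InCopy t y
  dist≤2-in-copy t x∈t (inj₁ refl)                   = x∈t
  dist≤2-in-copy t x∈t (inj₂ (inj₁ x∼y))             = adjacent-in-copy t x∈t x∼y
  dist≤2-in-copy t x∈t (inj₂ (inj₂ (_ , x∼w , w∼y))) =
    adjacent-in-copy t (adjacent-in-copy t x∈t x∼w) w∼y

  onCopies : (Copy → Automorphism G) → Automorphism GG
  onCopies α = record
    { σ = along Automorphism.σ ; σ⁻¹ = along Automorphism.σ⁻¹
    ; inv₁ = inverse Automorphism.σ Automorphism.σ⁻¹ Automorphism.inv₁
    ; inv₂ = inverse Automorphism.σ⁻¹ Automorphism.σ Automorphism.inv₂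
    ; pres = pres }
    where
    along : (Automorphism G → Fin (n G) → Fin (n G)) → Fin (n GG) → Fin (n GG)
    along f = copywise (λ s i → copy s (f (α s) i))
    inverse : (f g : Automorphism G → Fin (n G) → Fin (n G)) →
              (∀ φ i → f φ (g φ i) ≡ i) → ∀ x → along f (along g x) ≡ x
    inverse f g fg x with copyView x
    ... | ⟨ s , i ⟩ rewrite copywise-copy (λ s i → copy s (g (α s) i)) s i
                          | copywise-copy (λ s i → copy s (f (α s) i)) s (g (α s) i)
                          = cong (copy s) (fg (α s) i)
    pres : ∀ x y → E GG (along Automorphism.σ x) (along Automorphism.σ y) ≡ E GG x y
    pres x y with copyView x | copyView y
    ... | ⟨ s , i ⟩ | ⟨ t , j ⟩
      rewrite copywise-copy (λ s i → copy s (Automorphism.σ (α s) i)) s i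
            | copywise-copy (λ s i → copy s (Automorphism.σ (α s) i)) t j
      with s ≟ᶜ t
    ... | yes refl = trans (copy-adj s _ _) (trans (Automorphism.pres (α s) i j) (sym (copy-adj s i j)))
    ... | no  s≢t  = trans (copy-cross s t s≢t _ _) (sym (copy-cross s t s≢t i j))

  onCopies-copy : ∀ α s i → Automorphism.σ (onCopies α) (copy s i) ≡ copy s (Automorphism.σ (α s) i)
  onCopies-copy α = copywise-copy (λ s i → copy s (Automorphism.σ (α s) i))

  restrictColoring : ∀ {k} → DistColoring GG k → DistMap G k
  restrictColoring D = record
    { c = c ∘ copy left
    ; independent = λ i j e → trans (sym (copy-adj left i j)) (independent _ _ e)
    ; distinguish = fixes }
    where
    open DistColoring D
    fixes : ∀ (ρ : Automorphism G) → (∀ i → c (copy left (Automorphism.σ ρ i)) ≡ c (copy left i)) →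
            ∀ i → Automorphism.σ ρ i ≡ i
    fixes ρ keeps i = proj₂ (copy-injective {left} {left}
      (trans (sym (onCopies-copy α left i)) (distinguish (onCopies α) keeps′ (copy left i))))
      where
      α : Copy → Automorphism G
      α left  = ρ
      α right = idAut G
      keeps′ : ∀ x → c (Automorphism.σ (onCopies α) x) ≡ c x
      keeps′ x with copyView x
      ... | ⟨ left  , j ⟩ rewrite onCopies-copy α left j  = keeps j
      ... | ⟨ right , j ⟩ rewrite onCopies-copy α right j = refl

  image-in-copy : Diameter≤2 G → ∀ (ψ : Automorphism GG) s t y₀ →
    InCopy t (Automorphism.σ ψ (copy s y₀)) → ∀ y → InCopy t (Automorphism.σ ψ (copy s y))
  image-in-copy diam ψ s t y₀ y₀↦t y =
    dist≤2-in-copy t y₀↦t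
      (map-dist≤2 {GG} {GG} (Automorphism.σ ψ) (Automorphism.pres ψ)
        (map-dist≤2 {G} {GG} (copy s) (copy-adj s) (diam y₀ y)))

  module Restrict (diam : Diameter≤2 G) (φ : Automorphism GG)
                  (s t : Copy) (y₀ : Fin (n G)) (y₀↦t : InCopy t (Automorphism.σ φ (copy s y₀))) where
    open Automorphism φ

    private
      ρσ : Fin (n G) → Fin (n G)
      ρσ y = proj₁ (image-in-copy diam φ s t y₀ y₀↦t y)

      ρσ-spec : ∀ y → σ (copy s y) ≡ copy t (ρσ y)
      ρσ-spec y = proj₂ (image-in-copy diam φ s t y₀ y₀↦t y)

      back : ∀ y → σ⁻¹ (copy t (ρσ y)) ≡ copy s y
      back y = trans (cong σ⁻¹ (sym (ρσ-spec y))) (inv₂ (copy s y))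

      ρσ⁻¹ : Fin (n G) → Fin (n G)
      ρσ⁻¹ y = proj₁ (image-in-copy diam (aut⁻¹ φ) t s (ρσ y₀) (y₀ , back y₀) y)

      ρσ⁻¹-spec : ∀ y → σ⁻¹ (copy t y) ≡ copy s (ρσ⁻¹ y)
      ρσ⁻¹-spec y = proj₂ (image-in-copy diam (aut⁻¹ φ) t s (ρσ y₀) (y₀ , back y₀) y)

    restrict : Automorphism G
    restrict = record
      { σ = ρσ ; σ⁻¹ = ρσ⁻¹
      ; inv₁ = λ y → proj₂ (copy-injective {t} {t} (begin
          copy t (ρσ (ρσ⁻¹ y)) ≡⟨ ρσ-spec (ρσ⁻¹ y) ⟨
          σ (copy s (ρσ⁻¹ y))  ≡⟨ cong σ (ρσ⁻¹-spec y) ⟨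
          σ (σ⁻¹ (copy t y))   ≡⟨ inv₁ (copy t y) ⟩
          copy t y             ∎))
      ; inv₂ = λ y → proj₂ (copy-injective {s} {s} (begin
          copy s (ρσ⁻¹ (ρσ y)) ≡⟨ ρσ⁻¹-spec (ρσ y) ⟨
          σ⁻¹ (copy t (ρσ y))  ≡⟨ back y ⟩
          copy s y             ∎))
      ; pres = λ i j → begin
          E G (ρσ i) (ρσ j)                    ≡⟨ copy-adj t (ρσ i) (ρσ j) ⟨
          E GG (copy t (ρσ i)) (copy t (ρσ j)) ≡⟨ cong₂ (E GG) (ρσ-spec i) (ρσ-spec j) ⟨
          E GG (σ (copy s i)) (σ (copy s j))   ≡⟨ pres (copy s i) (copy s j) ⟩
          E GG (copy s i) (copy s j)           ≡⟨ copy-adj s i j ⟩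
          E G i j                              ∎ }
      where open ≡-Reasoning

    restrict-spec : ∀ y → σ (copy s y) ≡ copy t (Automorphism.σ restrict y)
    restrict-spec = ρσ-spec

module Lift {G : Graph} (diam : Diameter≤2 G) {x₀ : Fin (n G)} (nnt : NonNeighboursAreTwins G x₀)
            {k : ℕ} (D : DistColoring G k) (k<n : k < n G) where
  open Double G
  open DistColoring D

  private
    clash = pigeonhole k<n c
    p = proj₁ clash
    q = proj₁ (proj₂ clash)
    p≢q : p ≢ q
    p≢q = <⇒≢ (proj₁ (proj₂ (proj₂ clash)))
    cp≡cq : c p ≡ c q
    cp≡cq = proj₂ (proj₂ (proj₂ clash))

  π : Fin k → Fin k
  π = transpose (c x₀) (c p)

  π⁻¹ : Fin k → Fin k
  π⁻¹ = transpose (c p) (c x₀)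

  π⁻¹-π : ∀ a → π⁻¹ (π a) ≡ a
  π⁻¹-π a = transpose-inverse (c p) (c x₀)

  π-injective : ∀ {a b} → π a ≡ π b → a ≡ b
  π-injective {a} {b} e = trans (sym (π⁻¹-π a)) (trans (cong π⁻¹ e) (π⁻¹-π b))

  colours : Copy → Fin (n G) → Fin k
  colours left  = c
  colours right = π ∘ c

  colours-finer : ∀ s {i j} → colours s i ≡ colours s j → c i ≡ c j
  colours-finer left  e = e
  colours-finer right e = π-injective e

  d : Fin (n GG) → Fin k
  d = copywise colours

  d-independent : ∀ x y → d x ≡ d y → E GG x y ≡ false
  d-independent x y with copyView x | copyView y
  ... | ⟨ s , i ⟩ | ⟨ t , j ⟩ rewrite copywise-copy colours s i | copywise-copy colours t j = go s t
    where
    go : ∀ s t → colours s i ≡ colours t j → E GG (copy s i) (copy t j) ≡ false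
    go s t e with s ≟ᶜ t
    ... | yes refl = trans (copy-adj s i j) (independent i j (colours-finer s e))
    ... | no  s≢t  = copy-cross s t s≢t i j

  module _ (φ : Automorphism GG) (keeps : ∀ x → d (Automorphism.σ φ x) ≡ d x) where
    open Automorphism φ

    module _ (s t : Copy) (y₀ : Fin (n G)) (y₀↦t : InCopy t (σ (copy s y₀))) where
      open Restrict diam φ s t y₀ y₀↦t

      restrict-colours : ∀ y → colours t (Automorphism.σ restrict y) ≡ colours s y
      restrict-colours y = begin
        colours t (Automorphism.σ restrict y) ≡⟨ copywise-copy colours t _ ⟨
        d (copy t (Automorphism.σ restrict y)) ≡⟨ cong d (restrict-spec y) ⟨
        d (σ (copy s y))                       ≡⟨ keeps (copy s y) ⟩
        d (copy s y)                           ≡⟨ copywise-copy colours s y ⟩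
        colours s y                            ∎
        where open ≡-Reasoning

    fixes-copy : ∀ s y₀ (y₀↦s : InCopy s (σ (copy s y₀))) y → σ (copy s y) ≡ copy s y
    fixes-copy s y₀ y₀↦s y = trans (restrict-spec y) (cong (copy s) (distinguish restrict keeps-c y))
      where
      open Restrict diam φ s s y₀ y₀↦s
      keeps-c : ∀ i → c (Automorphism.σ restrict i) ≡ c i
      keeps-c i = colours-finer s (restrict-colours s s y₀ y₀↦s i)

    -- Exchanging the copies would send both p and q into the singleton class of x₀.
    left-not-to-right : InCopy right (σ (copy left x₀)) → ⊥
    left-not-to-right x₀↦right =
      p≢q (σ-injective restrict (trans (to-x₀ p refl) (sym (to-x₀ q (sym cp≡cq)))))
      where
      open Restrict diam φ left right x₀ x₀↦right
      to-x₀ : ∀ y → c y ≡ c p → Automorphism.σ restrict y ≡ x₀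
      to-x₀ y cy≡cp = colour-class-singleton nnt D _ (begin
        c (Automorphism.σ restrict y)           ≡⟨ π⁻¹-π _ ⟨
        π⁻¹ (π (c (Automorphism.σ restrict y))) ≡⟨ cong π⁻¹ (restrict-colours left right x₀ x₀↦right y) ⟩
        π⁻¹ (c y)                               ≡⟨ cong π⁻¹ cy≡cp ⟩
        π⁻¹ (c p)                               ≡⟨ transpose-first (c p) (c x₀) ⟩
        c x₀                                    ∎)
        where open ≡-Reasoning

    fixes-all : ∀ x → σ x ≡ x
    fixes-all with copyOf (σ (copy left x₀))
    ... | right , x₀↦right = ⊥-elim (left-not-to-right x₀↦right)
    ... | left  , x₀↦left  = fixes
      where
      left-fixed = fixes-copy left x₀ x₀↦left
      right-stays : InCopy right (σ (copy right x₀))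
      right-stays with copyOf (σ (copy right x₀))
      ... | right , h = h
      ... | left  , (z , e) with proj₁ (copy-injective {right} {left}
                                   (σ-injective φ (trans e (sym (left-fixed z)))))
      ...   | ()
      fixes : ∀ x → σ x ≡ x
      fixes x with copyView x
      ... | ⟨ left  , i ⟩ = left-fixed i
      ... | ⟨ right , i ⟩ = fixes-copy right x₀ right-stays i

  liftColoring : DistColoring GG k
  liftColoring = record
    { c = d
    ; nonempty = λ a → copy left (proj₁ (nonempty a)) ,
                       trans (copywise-copy colours left _) (proj₂ (nonempty a))
    ; independent = d-independent
    ; distinguish = fixes-all }

χD-bound : ∀ {G k m} → DistColoring G m → (∀ j → j < k → DistColoring G j → ⊥) → k ≤ m
χD-bound D minimal = ≮⇒≥ (λ m<k → minimal _ m<k D)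

χD-double : ∀ {G} → Diameter≤2 G → ∀ {x₀} → NonNeighboursAreTwins G x₀ → SplitNonEdge G → ∀ k →
  (IsChiD G k → IsChiD (G ∪ G) k) × (IsChiD (G ∪ G) k → IsChiD G k)
χD-double {G} diam {x₀} nnt split k = to-double , from-double
  where
  open Double G

  pred-n<n : pred (n G) < n G
  pred-n<n = m≤pred[n]⇒suc[m]≤n {{nonZeroIndex x₀}} ≤-refl

  lift : ∀ {j} → j < n G → DistColoring G j → DistColoring GG j
  lift j<n D = Lift.liftColoring diam nnt D j<n

  restrict : ∀ {j} → j ≤ n G → DistColoring GG j → DistColoring G j
  restrict j≤n D = Surjectify.surjectify j≤n (restrictColoring D)

  to-double : IsChiD G k → IsChiD GG k
  to-double (D , minimal) = lift k<n D , λ j j<k D′ → minimal j j<k (restrict (<⇒≤ (<-trans j<k k<n)) D′)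
    where
    k<n : k < n G
    k<n = ≤-<-trans (χD-bound (identifyColoring G (irreflexive D) split) minimal) pred-n<n

  from-double : IsChiD GG k → IsChiD G k
  from-double (D , minimal) = restrict (<⇒≤ k<n) D , λ j j<k D′ → minimal j j<k (lift (<-trans j<k k<n) D′)
    where
    irr : Irreflexive G
    irr i = trans (sym (copy-adj left i i)) (irreflexive D (copy left i))
    k<n : k < n G
    k<n = ≤-<-trans (χD-bound (lift pred-n<n (identifyColoring G irr split)) minimal) pred-n<n

join-diameter≤2 : ∀ {G H} → Fin (n G) → Fin (n H) → Diameter≤2 (G ⊕ H)
join-diameter≤2 {G} {H} g h y z with view (n G) (n H) y | view (n G) (n H) z
... | L i | L j = inj₂ (inj₂ (n G ↑ʳ h , ⊕-lr G H i h , ⊕-rl G H h j))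
... | L i | R j = inj₂ (inj₁ (⊕-lr G H i j))
... | R i | L j = inj₂ (inj₁ (⊕-rl G H i j))
... | R i | R j = inj₂ (inj₂ (g ↑ˡ n H , ⊕-rl G H i g , ⊕-lr G H g j))

twins-⊕ˡ : ∀ {G H u w} → Twins G u w → Twins (G ⊕ H) (u ↑ˡ n H) (w ↑ˡ n H)
twins-⊕ˡ {G} {H} {u} {w} (row , column) = row′ , column′
  where
  row′ : ∀ y → E (G ⊕ H) (u ↑ˡ n H) y ≡ E (G ⊕ H) (w ↑ˡ n H) y
  row′ y with view (n G) (n H) y
  ... | L j = trans (⊕-ll G H u j) (trans (row j) (sym (⊕-ll G H w j)))
  ... | R j = trans (⊕-lr G H u j) (sym (⊕-lr G H w j))
  column′ : ∀ y → E (G ⊕ H) y (u ↑ˡ n H) ≡ E (G ⊕ H) y (w ↑ˡ n H)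
  column′ y with view (n G) (n H) y
  ... | L j = trans (⊕-ll G H j u) (trans (column j) (sym (⊕-ll G H j w)))
  ... | R j = trans (⊕-rl G H j u) (sym (⊕-rl G H j w))

nonNeighboursAreTwins-⊕ˡ : ∀ {G H x} → NonNeighboursAreTwins G x → NonNeighboursAreTwins (G ⊕ H) (x ↑ˡ n H)
nonNeighboursAreTwins-⊕ˡ {G} {H} {x} nnt y x≁y with view (n G) (n H) y
... | L j = twins-⊕ˡ (nnt j (trans (sym (⊕-ll G H x j)) x≁y))
... | R j with trans (sym x≁y) (⊕-lr G H x j)
...   | ()

nonNeighboursAreTwins-Kbar : ∀ r x → NonNeighboursAreTwins (Kbar r) x
nonNeighboursAreTwins-Kbar r x _ _ = (λ _ → refl) , (λ _ → refl)

splitNonEdge-⊕ʳ : ∀ {G H} → SplitNonEdge H → SplitNonEdge (G ⊕ H)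
splitNonEdge-⊕ʳ {G} {H} (splitNonEdge u v w u≁v v≁u u∼w v≁w) =
  splitNonEdge (n G ↑ʳ u) (n G ↑ʳ v) (n G ↑ʳ w)
    (trans (⊕-rr G H u v) u≁v) (trans (⊕-rr G H v u) v≁u)
    (trans (⊕-rr G H u w) u∼w) (trans (⊕-rr G H v w) v≁w)

χD-double-CMP⊕ : ∀ A X → SplitNonEdge X → ∀ k →
  (IsChiD (CMP A ⊕ X) k → IsChiD ((CMP A ⊕ X) ∪ (CMP A ⊕ X)) k)
  × (IsChiD ((CMP A ⊕ X) ∪ (CMP A ⊕ X)) k → IsChiD (CMP A ⊕ X) k)
χD-double-CMP⊕ (p ∷ ps) X split =
  χD-double (join-diameter≤2 {CMP (p ∷ ps)} {X} x₀ (SplitNonEdge.u split))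
            {x₀ ↑ˡ n X} (nonNeighboursAreTwins-⊕ˡ {CMP (p ∷ ps)} {X} {x₀} x₀-twins)
            (splitNonEdge-⊕ʳ split)
  where
  x₀ : Fin (n (CMP (p ∷ ps)))
  x₀ = fz ↑ˡ n (CMPl ps)
  x₀-twins : NonNeighboursAreTwins (CMP (p ∷ ps)) x₀
  x₀-twins = nonNeighboursAreTwins-⊕ˡ {Kbar (suc p)} {CMPl ps} {fz} (nonNeighboursAreTwins-Kbar (suc p) fz)

inBlock : (m : ℕ) (H : Fin m → Graph) (i : Fin m) → Fin (n (H i)) → Fin (vsize m H)
inBlock (suc m) H fz     a = a ↑ˡ vsize m (λ i → H (fs i))
inBlock (suc m) H (fs i) a = n (H fz) ↑ʳ inBlock m (λ i → H (fs i)) i a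

locate-inBlock : ∀ m H i a → locate m H (inBlock m H i a) ≡ (i , a)
locate-inBlock (suc m) H fz a rewrite splitAt-↑ˡ (n (H fz)) a (vsize m (λ i → H (fs i))) = refl
locate-inBlock (suc m) H (fs i) a
  rewrite splitAt-↑ʳ (n (H fz)) (vsize m (λ i → H (fs i))) (inBlock m (λ i → H (fs i)) i a)
        | locate-inBlock m (λ i → H (fs i)) i a = refl

substF-between : ∀ F H i j a b → i ≢ j →
  E (substF F H) (inBlock (n F) H i a) (inBlock (n F) H j b) ≡ E F i j
substF-between F H i j a b i≢j
  rewrite locate-inBlock (n F) H i a | locate-inBlock (n F) H j b with i ≟ j
... | yes i≡j = ⊥-elim (i≢j i≡j)
... | no _    = refl

splitNonEdge-subst : ∀ F (Hs : Vec Graph (n F)) (i j l : Fin (n F)) →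
  Fin (n (lookup Hs i)) → Fin (n (lookup Hs j)) → Fin (n (lookup Hs l)) →
  i ≢ j → i ≢ l → j ≢ l →
  E F i j ≡ false → E F j i ≡ false → E F i l ≡ true → E F j l ≡ false → SplitNonEdge (F ⟨ Hs ⟩)
splitNonEdge-subst F Hs i j l a b c i≢j i≢l j≢l i≁j j≁i i∼l j≁l =
  splitNonEdge (at i a) (at j b) (at l c)
    (trans (between i j a b i≢j) i≁j) (trans (between j i b a (λ e → i≢j (sym e))) j≁i)
    (trans (between i l a c i≢l) i∼l) (trans (between j l b c j≢l) j≁l)
  where
  at = inBlock (n F) (lookup Hs)
  between = substF-between F (lookup Hs)

splitNonEdge-∪ˡ : ∀ {S T} x z → E S x z ≡ true → Fin (n T) → SplitNonEdge (S ∪ T)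
splitNonEdge-∪ˡ {S} {T} x z x∼z t =
  splitNonEdge (x ↑ˡ n T) (n S ↑ʳ t) (z ↑ˡ n T)
    (∪-lr S T x t) (∪-rl S T t x) (trans (∪-ll S T x z) x∼z) (∪-rl S T t z)

splitNonEdge-∪ʳ : ∀ {S T} → Fin (n S) → ∀ x z → E T x z ≡ true → SplitNonEdge (S ∪ T)
splitNonEdge-∪ʳ {S} {T} s x z x∼z =
  splitNonEdge (n S ↑ʳ x) (s ↑ˡ n T) (n S ↑ʳ z)
    (∪-rl S T x s) (∪-lr S T s x) (trans (∪-rr S T x z) x∼z) (∪-lr S T s z)

listed-splitNonEdge : ∀ X → Listed X → SplitNonEdge X
listed-splitNonEdge _ l2K₂ = splitNonEdge v1 v3 v2 refl refl refl refl
listed-splitNonEdge _ (lHK₁ p q qs) =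
  splitNonEdge-∪ˡ {CMPl (p ∷ q ∷ qs)} {K₁} (fz ↑ˡ n (CMPl (q ∷ qs))) (suc p ↑ʳ fz)
    (⊕-lr (Kbar (suc p)) (CMPl (q ∷ qs)) fz fz) fz
listed-splitNonEdge _ lP₅ = splitNonEdge v1 v4 v2 refl refl refl refl
listed-splitNonEdge _ lC₅ = splitNonEdge v1 v3 v5 refl refl refl refl
listed-splitNonEdge _ lC₆ = splitNonEdge v1 v3 v6 refl refl refl refl
listed-splitNonEdge _ l2K₃ = splitNonEdge v1 v4 v2 refl refl refl refl
listed-splitNonEdge _ (lKbarK₂ (suc r) _) = splitNonEdge-∪ʳ {Kbar (suc r)} {K 2} fz v1 v2 refl
listed-splitNonEdge _ (lK₂K₂ (suc r) _ h₁) = splitNonEdge-∪ʳ {T = K 2} fz v1 v2 refl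
listed-splitNonEdge _ (lK₃K₂ (p ∷ ps) h₂ h₃) = splitNonEdge-∪ʳ {T = K 2} fz v1 v2 refl
listed-splitNonEdge _ (lK₂Kbar₂ (p ∷ ps) (q ∷ qs)) =
  splitNonEdge-∪ˡ {K̂₂ ⟨ Hs ⟩} {Kbar 2} (inBlock 2 (lookup Hs) v1 fz) (inBlock 2 (lookup Hs) v2 fz)
    (substF-between K̂₂ (lookup Hs) v1 v2 fz fz (λ ())) fz
  where Hs = CMP (p ∷ ps) ∷ᵥ CMP (q ∷ qs) ∷ᵥ []ᵥ
listed-splitNonEdge _ l2K₂2K₂ = splitNonEdge v1 v3 v2 refl refl refl refl
listed-splitNonEdge _ (l2K₂K₂K₁ h₁ h₂) = splitNonEdge v1 v3 v2 refl refl refl refl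
listed-splitNonEdge _ l2K₂K₁ = splitNonEdge v1 v3 v2 refl refl refl refl
listed-splitNonEdge _ (l2K₂HK₁ h₁) = splitNonEdge v1 v3 v2 refl refl refl refl
listed-splitNonEdge _ (lG₃a (p ∷ ps) (q ∷ qs) (r ∷ rs)) =
  splitNonEdge-subst Ĝ₃a (CMP (p ∷ ps) ∷ᵥ CMP (q ∷ qs) ∷ᵥ CMP (r ∷ rs) ∷ᵥ K₁ ∷ᵥ K₁ ∷ᵥ []ᵥ)
    v4 v5 v2 fz fz fz (λ ()) (λ ()) (λ ()) refl refl refl refl
listed-splitNonEdge _ (lG₃b (p ∷ ps) (q ∷ qs) (r ∷ rs)) =
  splitNonEdge-subst Ĝ₃b (CMP (p ∷ ps) ∷ᵥ CMP (q ∷ qs) ∷ᵥ CMP (r ∷ rs) ∷ᵥ K₁ ∷ᵥ K₁ ∷ᵥ []ᵥ)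
    v1 v4 v3 fz fz fz (λ ()) (λ ()) (λ ()) refl refl refl refl
listed-splitNonEdge _ (lG₅a (p ∷ ps) (q ∷ qs)) =
  splitNonEdge-subst Ĝ₅ (CMP (p ∷ ps) ∷ᵥ CMP (q ∷ qs) ∷ᵥ K₁ ∷ᵥ K₁ ∷ᵥ []ᵥ)
    v4 v1 v3 fz fz fz (λ ()) (λ ()) (λ ()) refl refl refl refl
listed-splitNonEdge _ (lG₅b (p ∷ ps) (q ∷ qs)) =
  splitNonEdge-subst Ĝ₅ (K₁ ∷ᵥ CMP (p ∷ ps) ∷ᵥ CMP (q ∷ qs) ∷ᵥ K₁ ∷ᵥ []ᵥ)
    v1 v4 v2 fz fz fz (λ ()) (λ ()) (λ ()) refl refl refl refl
listed-splitNonEdge _ (lG₆ (p ∷ ps) (q ∷ qs) (r ∷ rs)) =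
  splitNonEdge-subst Ĝ₆ (K₁ ∷ᵥ CMP (p ∷ ps) ∷ᵥ CMP (q ∷ qs) ∷ᵥ CMP (r ∷ rs) ∷ᵥ K₁ ∷ᵥ []ᵥ)
    v1 v5 v2 fz fz fz (λ ()) (λ ()) (λ ()) refl refl refl refl
listed-splitNonEdge _ (lG₇ (p ∷ ps) (q ∷ qs) (r ∷ rs) (s ∷ ss)) =
  splitNonEdge-subst Ĝ₇ (CMP (p ∷ ps) ∷ᵥ CMP (q ∷ qs) ∷ᵥ CMP (r ∷ rs) ∷ᵥ CMP (s ∷ ss) ∷ᵥ K₁ ∷ᵥ K₁ ∷ᵥ []ᵥ)
    v4 v6 v3 fz fz fz (λ ()) (λ ()) (λ ()) refl refl refl refl

lemma5p9 : (A : List⁺ ℕ) (X : Graph) → Listed X → (k : ℕ) →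
    (IsChiD (CMP A ⊕ X) k → IsChiD ((CMP A ⊕ X) ∪ (CMP A ⊕ X)) k)
    × (IsChiD ((CMP A ⊕ X) ∪ (CMP A ⊕ X)) k → IsChiD (CMP A ⊕ X) k)
lemma5p9 A X listed = χD-double-CMP⊕ A X (listed-splitNonEdge X listed)
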